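{- If there is an $\mathcal L$-derivation of a (ground, normal-form) sequent $\Gamma\vdash M$, then there is an $\mathcal L$-derivation of the same sequent whose length (number of sequents/rule applications along it) is at most $\#St(\Gamma\cup\{M\})$.
   Context: Messages: names and terms built from constructors $\mathsf{pub}$ (unary), $\mathsf{sign}$, $\mathsf{blind}$, $\langle\cdot,\cdot\rangle$, $\{\cdot\}_\cdot$ (binary) and function symbols of a finite signature $\Sigma_E$ disjoint from the constructors; ground. $E$: equational theory over $\Sigma_E$ with at most one AC symbol $\oplus$, presented by a rewrite system terminating and confluent modulo AC; $\equiv$: equality modulo AC; $\approx_E$: modulo $E$; terms in sequents are $E$-normal. $E$-alien: headed by a symbol not in $\Sigma_E$; an $E$-alien subterm $A$ of $N$ is an $E$-factor of $N$ if it is an immediate subterm of a subterm of $N$ headed by a symbol of $\Sigma_E$ (of a set: of some member). $E$-context: built from holes using only symbols of $\Sigma_E$. $\Gamma,M$ means $\Gamma\cup\{M\}$. $\Gamma\Vdash_{\mathcal R}M$: $\Gamma\vdash M$ derivable using only (id) $\Gamma\vdash M$ if $M\approx_E C[M_1,\ldots,M_k]$ for an $E$-context $C$, $M_i\in\Gamma$, and the right rules: from $\Gamma\vdash M,\Gamma\vdash N$ infer $\Gamma\vdash g(M,N)$, $g\in\{\langle\cdot,\cdot\rangle,\{\cdot\}_\cdot,\mathsf{sign},\mathsf{blind}\}$. System $\mathcal L$ (single premise $\Rightarrow$ conclusion, so derivations are linear): (r) $\Gamma\vdash M$ if $\Gamma\Vdash_{\mathcal R}M$; (lp) $\Gamma,\langle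 M,N\rangle,M,N\vdash T\Rightarrow\Gamma,\langle M,N\rangle\vdash T$; (le) $\Gamma,\{M\}_K,M,K\vdash N\Rightarrow\Gamma,\{M\}_K\vdash N$ if $\Gamma,\{M\}_K\Vdash_{\mathcal R}K$; ($\mathsf{sign}$) $\Gamma,\mathsf{sign}(M,K),\mathsf{pub}(L),M\vdash N\Rightarrow\Gamma,\mathsf{sign}(M,K),\mathsf{pub}(L)\vdash N$ if $K\equiv L$; ($\mathsf{blind}_1$) $\Gamma,\mathsf{blind}(M,K),M,K\vdash N\Rightarrow\Gamma,\mathsf{blind}(M,K)\vdash N$ if $\Gamma,\mathsf{blind}(M,K)\Vdash_{\mathcal R}K$; ($\mathsf{blind}_2$) $\Gamma,\mathsf{sign}(\mathsf{blind}(M,R),K),\mathsf{sign}(M,K),R\vdash N\Rightarrow\Gamma,\mathsf{sign}(\mathsf{blind}(M,R),K)\vdash N$ if $\Gamma,\mathsf{sign}(\mathsf{blind}(M,R),K)\Vdash_{\mathcal R}R$; (ls) $\Gamma,A\vdash M\Rightarrow\Gamma\vdash M$ if $A$ is an $E$-factor of $\Gamma\cup\{M\}$ and $\Gamma\Vdash_{\mathcal R}A$. $St(\Gamma)=\Gamma\cup pst(\Gamma)\cup\{\mathsf{sign}(M,N)\mid M,N\in pst(\Gamma)\}$, where $pst(\Gamma)$ is the set of proper subterms of members of $\Gamma$; $\#$ denotes cardinality. -}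

module Defs where

open import Data.Nat using (ℕ; suc)
import Data.Nat as ℕ
open import Data.Fin using (Fin)
import Data.Fin as F
open import Data.Vec using (Vec; []; _∷_; _[_]≔_; toList)
open import Data.List using (List; []; _∷_; _++_; concatMap; map; length; deduplicate)
open import Data.List.Membership.Propositional using (_∈_)
open import Data.Maybe using (Maybe; just)
open import Data.Product using (Σ; _×_; _,_; ∃; ∃₂)
open import Data.Sum using (_⊎_)
open import Data.Unit using (⊤)
open import Data.Empty using (⊥)
open import Relation.Nullary using (¬_; Dec; yes; no)
open import Relation.Binary.PropositionalEquality using (_≡_; refl; subst; sym; cong; cong₂)
open import Relation.Binary.Construct.Closure.ReflexiveTransitive using (Star)
open import Relation.Binary.Construct.Closure.Equivalence using (EqClosure)
open import Induction.WellFounded using (WellFounded)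

record Sig : Set where
  field
    nsym  : ℕ
    arity : Fin nsym → ℕ

module _ (S : Sig) where
  open Sig S

  -- Ground messages. Names are natural numbers; enc M K stands for {M}_K,
  -- pair M N for ⟨M,N⟩; fn f args is a symbol of Σ_E applied to arguments.
  data Msg : Set where
    name  : ℕ → Msg
    pub   : Msg → Msg
    pair  : Msg → Msg → Msg
    enc   : Msg → Msg → Msg
    sign  : Msg → Msg → Msg
    blind : Msg → Msg → Msg
    fn    : (f : Fin nsym) → Vec Msg (arity f) → Msg

  -- Terms over Σ_E with variables (for rewrite rules and E-contexts).
  data ETm (V : Set) : Set where
    var : V → ETm V
    efn : (f : Fin nsym) → Vec (ETm V) (arity f) → ETm V

  mutual
    inst : ∀ {V} → (V → Msg) → ETm V → Msg
    inst σ (var x)    = σ x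
    inst σ (efn f ts) = fn f (instV σ ts)

    instV : ∀ {V n} → (V → Msg) → Vec (ETm V) n → Vec Msg n
    instV σ []       = []
    instV σ (t ∷ ts) = inst σ t ∷ instV σ ts

  data Ctx : Set where
    hole   : Ctx
    pubC   : Ctx → Ctx
    pairL  : Ctx → Msg → Ctx
    pairR  : Msg → Ctx → Ctx
    encL   : Ctx → Msg → Ctx
    encR   : Msg → Ctx → Ctx
    signL  : Ctx → Msg → Ctx
    signR  : Msg → Ctx → Ctx
    blindL : Ctx → Msg → Ctx
    blindR : Msg → Ctx → Ctx
    fnC    : (f : Fin nsym) → Fin (arity f) → Vec Msg (arity f) → Ctx → Ctx

  plug : Ctx → Msg → Msg
  plug hole t           = t
  plug (pubC C) t       = pub (plug C t)
  plug (pairL C b) t    = pair (plug C t) b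
  plug (pairR a C) t    = pair a (plug C t)
  plug (encL C b) t     = enc (plug C t) b
  plug (encR a C) t     = enc a (plug C t)
  plug (signL C b) t    = sign (plug C t) b
  plug (signR a C) t    = sign a (plug C t)
  plug (blindL C b) t   = blind (plug C t) b
  plug (blindR a C) t   = blind a (plug C t)
  plug (fnC f i as C) t = fn f (as [ i ]≔ plug C t)

  binop : (f : Fin nsym) → arity f ≡ 2 → Msg → Msg → Msg
  binop f p a b = fn f (subst (Vec Msg) (sym p) (a ∷ b ∷ []))

  record Theory : Set where
    field
      acSym : Maybe (Σ (Fin nsym) (λ f → arity f ≡ 2))
      rules : List (ETm ℕ × ETm ℕ)

  module _ (T : Theory) where
    open Theory T

    data ACAxiom : Msg → Msg → Set where
      assoc : ∀ f p a b c → acSym ≡ just (f , p) →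
              ACAxiom (binop f p a (binop f p b c)) (binop f p (binop f p a b) c)
      comm  : ∀ f p a b → acSym ≡ just (f , p) →
              ACAxiom (binop f p a b) (binop f p b a)

    data ACStep : Msg → Msg → Set where
      acstep : ∀ C s t → ACAxiom s t → ACStep (plug C s) (plug C t)

    _≡AC_ : Msg → Msg → Set
    _≡AC_ = EqClosure ACStep

    data RStep : Msg → Msg → Set where
      rstep : ∀ C l r (σ : ℕ → Msg) → (l , r) ∈ rules →
              RStep (plug C (inst σ l)) (plug C (inst σ r))

    RACStep : Msg → Msg → Set
    RACStep s t = ∃₂ λ s′ t′ → (s ≡AC s′) × RStep s′ t′ × (t′ ≡AC t)

    _≈E_ : Msg → Msg → Set
    _≈E_ = EqClosure (λ s t → RStep s t ⊎ ACStep s t)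

    Normal : Msg → Set
    Normal s = ∀ t → ¬ RACStep s t

    Terminating : Set
    Terminating = WellFounded (λ t s → RACStep s t)

    ConfluentModAC : Set
    ConfluentModAC = ∀ s t₁ t₂ → Star RACStep s t₁ → Star RACStep s t₂ →
      ∃₂ λ u₁ u₂ → Star RACStep t₁ u₁ × Star RACStep t₂ u₂ × (u₁ ≡AC u₂)

    Convergent : Set
    Convergent = Terminating × ConfluentModAC

  mutual
    subterms : Msg → List Msg
    subterms t = t ∷ psub t

    psub : Msg → List Msg
    psub (name _)    = []
    psub (pub a)     = subterms a
    psub (pair a b)  = subterms a ++ subterms b
    psub (enc a b)   = subterms a ++ subterms b
    psub (sign a b)  = subterms a ++ subterms b
    psub (blind a b) = subterms a ++ subterms b
    psub (fn f as)   = subtermsV as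

    subtermsV : ∀ {n} → Vec Msg n → List Msg
    subtermsV []       = []
    subtermsV (a ∷ as) = subterms a ++ subtermsV as

  pst : List Msg → List Msg
  pst Δ = concatMap psub Δ

  St : List Msg → List Msg
  St Δ = Δ ++ pst Δ ++ concatMap (λ a → map (sign a) (pst Δ)) (pst Δ)

  -- decidable (syntactic) equality, used for cardinality

  private
    fn-inj₁ : ∀ {f g as bs} → fn f as ≡ fn g bs → f ≡ g
    fn-inj₁ refl = refl
    fn-inj₂ : ∀ {f as bs} → fn f as ≡ fn f bs → as ≡ bs
    fn-inj₂ refl = refl

    dec2 : ∀ {a b c d} (k : Msg → Msg → Msg) →
           (∀ {a b c d} → k a b ≡ k c d → (a ≡ c) × (b ≡ d)) →
           Dec (a ≡ c) → Dec (b ≡ d) → Dec (k a b ≡ k c d)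
    dec2 k inj (yes refl) (yes refl) = yes refl
    dec2 k inj (no ¬p) _ = no λ e → ¬p (Data.Product.proj₁ (inj e))
    dec2 k inj (yes _) (no ¬q) = no λ e → ¬q (Data.Product.proj₂ (inj e))

  mutual
    _≟_ : (a b : Msg) → Dec (a ≡ b)
    name x ≟ name y with x ℕ.≟ y
    ... | yes refl = yes refl
    ... | no ¬p = no λ { refl → ¬p refl }
    pub a ≟ pub b with a ≟ b
    ... | yes refl = yes refl
    ... | no ¬p = no λ { refl → ¬p refl }
    pair a b ≟ pair c d = dec2 pair (λ { refl → refl , refl }) (a ≟ c) (b ≟ d)
    enc a b ≟ enc c d = dec2 enc (λ { refl → refl , refl }) (a ≟ c) (b ≟ d)
    sign a b ≟ sign c d = dec2 sign (λ { refl → refl , refl }) (a ≟ c) (b ≟ d)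
    blind a b ≟ blind c d = dec2 blind (λ { refl → refl , refl }) (a ≟ c) (b ≟ d)
    fn f as ≟ fn g bs with f F.≟ g
    ... | no ¬p = no λ e → ¬p (fn-inj₁ e)
    ... | yes refl with as ≟V bs
    ... | yes refl = yes refl
    ... | no ¬q = no λ e → ¬q (fn-inj₂ e)
    name _ ≟ pub _ = no λ ()
    name _ ≟ pair _ _ = no λ ()
    name _ ≟ enc _ _ = no λ ()
    name _ ≟ sign _ _ = no λ ()
    name _ ≟ blind _ _ = no λ ()
    name _ ≟ fn _ _ = no λ ()
    pub _ ≟ name _ = no λ ()
    pub _ ≟ pair _ _ = no λ ()
    pub _ ≟ enc _ _ = no λ ()
    pub _ ≟ sign _ _ = no λ ()
    pub _ ≟ blind _ _ = no λ ()
    pub _ ≟ fn _ _ = no λ ()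
    pair _ _ ≟ name _ = no λ ()
    pair _ _ ≟ pub _ = no λ ()
    pair _ _ ≟ enc _ _ = no λ ()
    pair _ _ ≟ sign _ _ = no λ ()
    pair _ _ ≟ blind _ _ = no λ ()
    pair _ _ ≟ fn _ _ = no λ ()
    enc _ _ ≟ name _ = no λ ()
    enc _ _ ≟ pub _ = no λ ()
    enc _ _ ≟ pair _ _ = no λ ()
    enc _ _ ≟ sign _ _ = no λ ()
    enc _ _ ≟ blind _ _ = no λ ()
    enc _ _ ≟ fn _ _ = no λ ()
    sign _ _ ≟ name _ = no λ ()
    sign _ _ ≟ pub _ = no λ ()
    sign _ _ ≟ pair _ _ = no λ ()
    sign _ _ ≟ enc _ _ = no λ ()
    sign _ _ ≟ blind _ _ = no λ ()
    sign _ _ ≟ fn _ _ = no λ ()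
    blind _ _ ≟ name _ = no λ ()
    blind _ _ ≟ pub _ = no λ ()
    blind _ _ ≟ pair _ _ = no λ ()
    blind _ _ ≟ enc _ _ = no λ ()
    blind _ _ ≟ sign _ _ = no λ ()
    blind _ _ ≟ fn _ _ = no λ ()
    fn _ _ ≟ name _ = no λ ()
    fn _ _ ≟ pub _ = no λ ()
    fn _ _ ≟ pair _ _ = no λ ()
    fn _ _ ≟ enc _ _ = no λ ()
    fn _ _ ≟ sign _ _ = no λ ()
    fn _ _ ≟ blind _ _ = no λ ()

    _≟V_ : ∀ {n} (as bs : Vec Msg n) → Dec (as ≡ bs)
    [] ≟V [] = yes refl
    (a ∷ as) ≟V (b ∷ bs) with a ≟ b | as ≟V bs
    ... | yes refl | yes refl = yes refl
    ... | no ¬p | _ = no λ { refl → ¬p refl }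
    ... | yes _ | no ¬q = no λ { refl → ¬q refl }

  card : List Msg → ℕ
  card Δ = length (deduplicate _≟_ Δ)

  EAlien : Msg → Set
  EAlien (fn _ _) = ⊥
  EAlien _        = ⊤

  EFactorOf : Msg → Msg → Set
  EFactorOf A N = EAlien A ×
    Σ (Fin nsym) (λ f → Σ (Vec Msg (arity f)) (λ as →
      (fn f as ∈ subterms N) × (A ∈ toList as)))

  EFactor : Msg → List Msg → Set
  EFactor A Δ = ∃ λ N → (N ∈ Δ) × EFactorOf A N

  -- the systems ⊩_R and 𝓛  (sets of messages represented by lists)

  module _ (T : Theory) where

    data _⊩_ (Γ : List Msg) : Msg → Set where
      ax     : ∀ {M} (k : ℕ) (C : ETm (Fin k)) (σ : Fin k → Msg) →
               (∀ i → σ i ∈ Γ) → _≈E_ T M (inst σ C) → Γ ⊩ M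
      rpair  : ∀ {M N} → Γ ⊩ M → Γ ⊩ N → Γ ⊩ pair M N
      renc   : ∀ {M N} → Γ ⊩ M → Γ ⊩ N → Γ ⊩ enc M N
      rsign  : ∀ {M N} → Γ ⊩ M → Γ ⊩ N → Γ ⊩ sign M N
      rblind : ∀ {M N} → Γ ⊩ M → Γ ⊩ N → Γ ⊩ blind M N

    -- Deriv Γ M n : an 𝓛-derivation of Γ ⊢ M consisting of n sequents
    data Deriv : List Msg → Msg → ℕ → Set where
      r      : ∀ {Γ M} → Γ ⊩ M → Deriv Γ M 1
      lp     : ∀ {Γ M N U n} → pair M N ∈ Γ →
               Deriv (M ∷ N ∷ Γ) U n → Deriv Γ U (suc n)
      le     : ∀ {Γ M K N n} → enc M K ∈ Γ → Γ ⊩ K →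
               Deriv (M ∷ K ∷ Γ) N n → Deriv Γ N (suc n)
      lsign  : ∀ {Γ M K L N n} → sign M K ∈ Γ → pub L ∈ Γ → _≡AC_ T K L →
               Deriv (M ∷ Γ) N n → Deriv Γ N (suc n)
      blind₁ : ∀ {Γ M K N n} → blind M K ∈ Γ → Γ ⊩ K →
               Deriv (M ∷ K ∷ Γ) N n → Deriv Γ N (suc n)
      blind₂ : ∀ {Γ M R K N n} → sign (blind M R) K ∈ Γ → Γ ⊩ R →
               Deriv (sign M K ∷ R ∷ Γ) N n → Deriv Γ N (suc n)
      ls     : ∀ {Γ M A n} → EFactor A (M ∷ Γ) → Γ ⊩ A →
               Deriv (A ∷ Γ) M n → Deriv Γ M (suc n)

module Submission where

open import Defs
open import Data.Nat using (ℕ; _≤_)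
open import Data.List using (List; _∷_)
open import Data.List.Relation.Unary.All using (All)
open import Data.Product using (Σ; _×_)

open import Data.Nat using (suc; _+_; _<_; z≤n; s≤s; _<?_)
open import Data.Nat.Properties using (≤-refl; ≤-trans; <-≤-trans; <⇒≤; <-irrefl; m≤m+n; m≤n+m; m≤n⇒m≤1+n; +-monoˡ-<)
open import Data.List using ([]; _++_; map; filter; length; deduplicate)
open import Data.List.Properties using (filter-notAll)
open import Data.List.Extrema.Nat using (argmax; argmax-sel; f[xs]≤f[argmax])
open import Data.List.Relation.Unary.Any using (here; there)
open import Data.List.Relation.Unary.All using ([]; _∷_; all?; tabulate) renaming (lookup to All-lookup)
open import Data.List.Relation.Unary.All.Properties using (¬All⇒Any¬) renaming (++⁺ to All-++⁺)
open import Data.List.Membership.Propositional using (_∈_; _∉_; find; lose)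
open import Data.List.Membership.Propositional.Properties
  using (∈-++⁺ˡ; ∈-++⁺ʳ; ∈-++⁻; ∈-concatMap⁺; ∈-concatMap⁻; ∈-map⁺; ∈-map⁻; ∈-deduplicate⁺)
open import Data.List.Relation.Binary.Subset.Propositional using (_⊆_)
open import Data.List.Relation.Binary.Subset.Propositional.Properties using (∷⁺ʳ)
open import Data.Vec using (Vec; toList) renaming ([] to []ᵥ; _∷_ to _∷ᵥ_)
open import Data.Product using (_,_)
open import Data.Sum using (_⊎_; inj₁; inj₂; [_,_]′)
open import Data.Empty using (⊥-elim)
open import Function using (id)
open import Relation.Nullary using (¬_; yes; no; ¬?)
open import Relation.Nullary.Decidable using (_×-dec_; _⊎-dec_)
open import Relation.Unary using (Decidable)
open import Relation.Binary.PropositionalEquality using (_≡_; refl; sym; subst)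

-- Call a set of messages Ok *closed* for the goal M if it contains
-- every proper subterm of its members and of M, and contains sign(a,k) whenever
-- it contains sign(blind(a,r),k).  Every left rule of 𝓛 only adds hypotheses
-- that are proper subterms of a hypothesis or of M, or (rule blind₂) such an
-- unblinded signature; so if Γ ⊆ Ok, all sequents of a derivation of Γ ⊢ M stay
-- inside Ok.  A left rule whose new hypotheses are already in Γ is useless and is
-- removed (by weakening), every remaining one adds a new element of Ok.  Hence
-- (`shorten`) Γ ⊢ M has a derivation of length ≤ 1 + #(Ok ∖ Γ).
--
-- For the theorem take U = St(M,Γ), let ⊤ be a member of U of maximal size and
-- Ok = Γ ∪ {x ∈ U | size x < size ⊤}.  Ok is closed, since subterms and
-- unblinded signatures are strictly smaller than a member of U; and ⊤ ∉ Ok ∖ Γ,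
-- so 1 + #(Ok ∖ Γ) ≤ #U.

module _ {A : Set} {P Q : A → Set} (P? : Decidable P) (Q? : Decidable Q)
         (P⇒Q : ∀ {x} → P x → Q x) where

  filter-length-mono : ∀ xs → length (filter P? xs) ≤ length (filter Q? xs)
  filter-length-mono [] = z≤n
  filter-length-mono (y ∷ xs) with P? y | Q? y
  ... | yes _  | yes _  = s≤s (filter-length-mono xs)
  ... | yes py | no ¬qy = ⊥-elim (¬qy (P⇒Q py))
  ... | no _   | yes _  = m≤n⇒m≤1+n (filter-length-mono xs)
  ... | no _   | no _   = filter-length-mono xs

  filter-length-< : ∀ {x} xs → x ∈ xs → Q x → ¬ P x →
                    length (filter P? xs) < length (filter Q? xs)
  filter-length-< (y ∷ xs) (here refl) qx ¬px with P? y | Q? y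
  ... | yes py | _      = ⊥-elim (¬px py)
  ... | no _   | yes _  = s≤s (filter-length-mono xs)
  ... | no _   | no ¬qy = ⊥-elim (¬qy qx)
  filter-length-< (y ∷ xs) (there x∈xs) qx ¬px with P? y | Q? y
  ... | yes _  | yes _  = s≤s (filter-length-< xs x∈xs qx ¬px)
  ... | yes py | no ¬qy = ⊥-elim (¬qy (P⇒Q py))
  ... | no _   | yes _  = m≤n⇒m≤1+n (filter-length-< xs x∈xs qx ¬px)
  ... | no _   | no _   = filter-length-< xs x∈xs qx ¬px

module Subterms (S : Sig) where

  mutual
    subterm-trans : ∀ t {y z} → y ∈ subterms S t → z ∈ subterms S y → z ∈ subterms S t
    subterm-trans t (here refl) z∈y = z∈y
    subterm-trans t (there y∈t) z∈y = there (psub-trans t y∈t z∈y)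

    psub-trans : ∀ t {y z} → y ∈ psub S t → z ∈ subterms S y → z ∈ psub S t
    psub-trans (name _)    ()
    psub-trans (pub a)     y∈t z∈y = subterm-trans a y∈t z∈y
    psub-trans (pair a b)  y∈t z∈y = subterm-trans₂ a b y∈t z∈y
    psub-trans (enc a b)   y∈t z∈y = subterm-trans₂ a b y∈t z∈y
    psub-trans (sign a b)  y∈t z∈y = subterm-trans₂ a b y∈t z∈y
    psub-trans (blind a b) y∈t z∈y = subterm-trans₂ a b y∈t z∈y
    psub-trans (fn f as)   y∈t z∈y = subtermsV-trans as y∈t z∈y

    subterm-trans₂ : ∀ a b {y z} → y ∈ subterms S a ++ subterms S b →
                     z ∈ subterms S y → z ∈ subterms S a ++ subterms S b
    subterm-trans₂ a b y∈ab z∈y with ∈-++⁻ (subterms S a) y∈ab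
    ... | inj₁ y∈a = ∈-++⁺ˡ (subterm-trans a y∈a z∈y)
    ... | inj₂ y∈b = ∈-++⁺ʳ (subterms S a) (subterm-trans b y∈b z∈y)

    subtermsV-trans : ∀ {n} (as : Vec (Msg S) n) {y z} → y ∈ subtermsV S as →
                      z ∈ subterms S y → z ∈ subtermsV S as
    subtermsV-trans []ᵥ       ()
    subtermsV-trans (a ∷ᵥ as) y∈as z∈y with ∈-++⁻ (subterms S a) y∈as
    ... | inj₁ y∈a  = ∈-++⁺ˡ (subterm-trans a y∈a z∈y)
    ... | inj₂ y∈as′ = ∈-++⁺ʳ (subterms S a) (subtermsV-trans as y∈as′ z∈y)

  argument-subterm : ∀ {n} (as : Vec (Msg S) n) {a} → a ∈ toList as → a ∈ subtermsV S as
  argument-subterm (a ∷ᵥ as) (here refl)  = here refl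
  argument-subterm (a ∷ᵥ as) (there a∈as) = ∈-++⁺ʳ (subterms S a) (argument-subterm as a∈as)

  factor-psub : ∀ {A N} → EFactorOf S A N → A ∈ psub S N
  factor-psub {A} (_ , f , as , here refl , A∈as) = argument-subterm as A∈as
  factor-psub {A} {N} (_ , f , as , there fas∈N , A∈as) =
    psub-trans N fas∈N (there (argument-subterm as A∈as))

  mutual
    size : Msg S → ℕ
    size (name _)    = 1
    size (pub a)     = suc (size a)
    size (pair a b)  = suc (size a + size b)
    size (enc a b)   = suc (size a + size b)
    size (sign a b)  = suc (size a + size b)
    size (blind a b) = suc (size a + size b)
    size (fn f as)   = suc (sizeV as)

    sizeV : ∀ {n} → Vec (Msg S) n → ℕ
    sizeV []ᵥ       = 0
    sizeV (a ∷ᵥ as) = size a + sizeV as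

  mutual
    subterm-≤ : ∀ t {z} → z ∈ subterms S t → size z ≤ size t
    subterm-≤ t (here refl) = ≤-refl
    subterm-≤ t (there z∈t) = <⇒≤ (psub-< t z∈t)

    psub-< : ∀ t {z} → z ∈ psub S t → size z < size t
    psub-< (name _)    ()
    psub-< (pub a)     z∈t = s≤s (subterm-≤ a z∈t)
    psub-< (pair a b)  z∈t = s≤s (subterm-≤₂ a b z∈t)
    psub-< (enc a b)   z∈t = s≤s (subterm-≤₂ a b z∈t)
    psub-< (sign a b)  z∈t = s≤s (subterm-≤₂ a b z∈t)
    psub-< (blind a b) z∈t = s≤s (subterm-≤₂ a b z∈t)
    psub-< (fn f as)   z∈t = s≤s (subtermsV-≤ as z∈t)

    subterm-≤₂ : ∀ a b {z} → z ∈ subterms S a ++ subterms S b → size z ≤ size a + size b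
    subterm-≤₂ a b z∈ab with ∈-++⁻ (subterms S a) z∈ab
    ... | inj₁ z∈a = ≤-trans (subterm-≤ a z∈a) (m≤m+n (size a) (size b))
    ... | inj₂ z∈b = ≤-trans (subterm-≤ b z∈b) (m≤n+m (size b) (size a))

    subtermsV-≤ : ∀ {n} (as : Vec (Msg S) n) {z} → z ∈ subtermsV S as → size z ≤ sizeV as
    subtermsV-≤ []ᵥ       ()
    subtermsV-≤ (a ∷ᵥ as) z∈as with ∈-++⁻ (subterms S a) z∈as
    ... | inj₁ z∈a   = ≤-trans (subterm-≤ a z∈a) (m≤m+n (size a) (sizeV as))
    ... | inj₂ z∈as′ = ≤-trans (subtermsV-≤ as z∈as′) (m≤n+m (sizeV as) (size a))

  unblind-< : ∀ a ρ k → size (sign a k) < size (sign (blind a ρ) k)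
  unblind-< a ρ k = s≤s (+-monoˡ-< (size k) (s≤s (m≤m+n (size a) (size ρ))))

module Saturation (S : Sig) (L : List (Msg S)) where
  open Subterms S

  P U : List (Msg S)
  P = pst S L
  U = St S L

  L⊆U : L ⊆ U
  L⊆U = ∈-++⁺ˡ

  P⊆U : P ⊆ U
  P⊆U y∈P = ∈-++⁺ʳ L (∈-++⁺ˡ y∈P)

  sign∈U : ∀ {a b} → a ∈ P → b ∈ P → sign a b ∈ U
  sign∈U {a} {b} a∈P b∈P =
    ∈-++⁺ʳ L (∈-++⁺ʳ P (∈-concatMap⁺ (λ x → map (sign x) P) (lose a∈P (∈-map⁺ (sign a) b∈P))))

  P-psub-closed : ∀ {y z} → y ∈ P → z ∈ psub S y → z ∈ P
  P-psub-closed y∈P z∈y with find (∈-concatMap⁻ (psub S) {xs = L} y∈P)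
  ... | w , w∈L , y∈w = ∈-concatMap⁺ (psub S) (lose w∈L (psub-trans w y∈w (there z∈y)))

  P-subterm-closed : ∀ {y z} → y ∈ P → z ∈ subterms S y → z ∈ P
  P-subterm-closed y∈P (here refl) = y∈P
  P-subterm-closed y∈P (there z∈y) = P-psub-closed y∈P z∈y

  psub∈P : ∀ {y z} → y ∈ U → z ∈ psub S y → z ∈ P
  psub∈P {y} y∈U z∈y with ∈-++⁻ L y∈U
  ... | inj₁ y∈L = ∈-concatMap⁺ (psub S) (lose y∈L z∈y)
  ... | inj₂ y∈PS with ∈-++⁻ P y∈PS
  ... | inj₁ y∈P = P-psub-closed y∈P z∈y
  ... | inj₂ y∈Sg with find (∈-concatMap⁻ (λ a → map (sign a) P) {xs = P} y∈Sg)
  ... | a , a∈P , y∈aP with ∈-map⁻ (sign a) y∈aP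
  ... | b , b∈P , refl with ∈-++⁻ (subterms S a) z∈y
  ... | inj₁ z∈a = P-subterm-closed a∈P z∈a
  ... | inj₂ z∈b = P-subterm-closed b∈P z∈b

  unblind∈U : ∀ {a ρ k} → sign (blind a ρ) k ∈ U → sign a k ∈ U
  unblind∈U {a} {ρ} s∈U =
    sign∈U (psub∈P s∈U (there (here refl)))
           (psub∈P s∈U (∈-++⁺ʳ (subterms S (blind a ρ)) (here refl)))

module Weakening (S : Sig) (T : Theory S) where

  weaken⊩ : ∀ {Γ Δ M} → Γ ⊆ Δ → _⊩_ S T Γ M → _⊩_ S T Δ M
  weaken⊩ Γ⊆Δ (ax k C σ σ∈Γ e) = ax k C σ (λ i → Γ⊆Δ (σ∈Γ i)) e
  weaken⊩ Γ⊆Δ (rpair a b)      = rpair (weaken⊩ Γ⊆Δ a) (weaken⊩ Γ⊆Δ b)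
  weaken⊩ Γ⊆Δ (renc a b)       = renc (weaken⊩ Γ⊆Δ a) (weaken⊩ Γ⊆Δ b)
  weaken⊩ Γ⊆Δ (rsign a b)      = rsign (weaken⊩ Γ⊆Δ a) (weaken⊩ Γ⊆Δ b)
  weaken⊩ Γ⊆Δ (rblind a b)     = rblind (weaken⊩ Γ⊆Δ a) (weaken⊩ Γ⊆Δ b)

  weaken : ∀ {Γ Δ M n} → Γ ⊆ Δ → Deriv S T Γ M n → Deriv S T Δ M n
  weaken Γ⊆Δ (r x)              = r (weaken⊩ Γ⊆Δ x)
  weaken Γ⊆Δ (lp p d)           = lp (Γ⊆Δ p) (weaken (∷⁺ʳ _ (∷⁺ʳ _ Γ⊆Δ)) d)
  weaken Γ⊆Δ (le p k d)         = le (Γ⊆Δ p) (weaken⊩ Γ⊆Δ k) (weaken (∷⁺ʳ _ (∷⁺ʳ _ Γ⊆Δ)) d)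
  weaken Γ⊆Δ (lsign p q e d)    = lsign (Γ⊆Δ p) (Γ⊆Δ q) e (weaken (∷⁺ʳ _ Γ⊆Δ) d)
  weaken Γ⊆Δ (blind₁ p k d)     = blind₁ (Γ⊆Δ p) (weaken⊩ Γ⊆Δ k) (weaken (∷⁺ʳ _ (∷⁺ʳ _ Γ⊆Δ)) d)
  weaken Γ⊆Δ (blind₂ p k d)     = blind₂ (Γ⊆Δ p) (weaken⊩ Γ⊆Δ k) (weaken (∷⁺ʳ _ (∷⁺ʳ _ Γ⊆Δ)) d)
  weaken Γ⊆Δ (ls (N , N∈ , f) a d) =
    ls (N , ∷⁺ʳ _ Γ⊆Δ N∈ , f) (weaken⊩ Γ⊆Δ a) (weaken (∷⁺ʳ _ Γ⊆Δ) d)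

-- A set of messages closed under the decompositions performed by the left
-- rules of 𝓛 when proving the goal M.
record Closed (S : Sig) (M : Msg S) (Ok : Msg S → Set) : Set where
  field
    psub-closed    : ∀ {y z} → Ok y ⊎ y ≡ M → z ∈ psub S y → Ok z
    unblind-closed : ∀ {a ρ k} → Ok (sign (blind a ρ) k) → Ok (sign a k)

module Shortening (S : Sig) (T : Theory S) (M : Msg S)
  (Ok : Msg S → Set) (ok? : Decidable Ok) (closed : Closed S M Ok)
  (D : List (Msg S)) (D-complete : ∀ {x} → Ok x → x ∈ D) where

  open Closed closed
  open Weakening S T
  open import Data.List.Membership.DecPropositional (_≟_ S) using (_∈?_)

  Missing : List (Msg S) → Msg S → Set
  Missing Γ x = Ok x × x ∉ Γ

  missing? : ∀ Γ → Decidable (Missing Γ)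
  missing? Γ x = ok? x ×-dec ¬? (x ∈? Γ)

  missing : List (Msg S) → ℕ
  missing Γ = length (filter (missing? Γ) D)

  missing-drops : ∀ {Γ X x} → All Ok X → x ∈ X → x ∉ Γ → missing (X ++ Γ) < missing Γ
  missing-drops {Γ} {X} okX x∈X x∉Γ =
    filter-length-< (missing? (X ++ Γ)) (missing? Γ) (λ { (okx , x∉XΓ) → okx , λ x∈Γ → x∉XΓ (∈-++⁺ʳ X x∈Γ) }) D
      (D-complete okx) (okx , x∉Γ) (λ { (_ , x∉XΓ) → x∉XΓ (∈-++⁺ˡ x∈X) })
    where okx = All-lookup okX x∈X

  missing-bound : ∀ {Γ w} → w ∈ D → (Ok w → w ∈ Γ) → suc (missing Γ) ≤ length D
  missing-bound w∈D ok⇒∈ = filter-notAll (missing? _) D (lose w∈D (λ { (okw , w∉Γ) → w∉Γ (ok⇒∈ okw) }))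

  Short : List (Msg S) → Set
  Short Γ = Σ ℕ (λ m → Deriv S T Γ M m × m ≤ suc (missing Γ))

  -- A left rule adding X to Γ, followed by a derivation that the induction
  -- hypothesis shortens: drop the rule if X ⊆ Γ, keep it otherwise.
  left-rule : ∀ {Γ n} X → All Ok X → All Ok Γ →
    (∀ {Δ} → All Ok Δ → Deriv S T Δ M n → Short Δ) →
    (∀ {m} → Deriv S T (X ++ Γ) M m → Deriv S T Γ M (suc m)) →
    Deriv S T (X ++ Γ) M n → Short Γ
  left-rule {Γ} X okX okΓ shorten′ rule d with all? (_∈? Γ) X
  ... | yes X⊆Γ = shorten′ okΓ (weaken (λ p → [ All-lookup X⊆Γ , id ]′ (∈-++⁻ X p)) d)
  ... | no X⊈Γ with find (¬All⇒Any¬ (_∈? Γ) X X⊈Γ) | shorten′ (All-++⁺ okX okΓ) d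
  ... | x , x∈X , x∉Γ | m , d′ , m≤ =
    suc m , rule d′ , s≤s (≤-trans m≤ (missing-drops okX x∈X x∉Γ))

  both : ∀ {y} a b → Ok y → a ∈ psub S y → b ∈ psub S y → All Ok (a ∷ b ∷ [])
  both a b oky a∈y b∈y = psub-closed (inj₁ oky) a∈y ∷ psub-closed (inj₁ oky) b∈y ∷ []

  first : ∀ a b → a ∈ subterms S a ++ subterms S b
  first a b = here refl

  second : ∀ a b → b ∈ subterms S a ++ subterms S b
  second a b = ∈-++⁺ʳ (subterms S a) (here refl)

  shorten : ∀ {Γ n} → All Ok Γ → Deriv S T Γ M n → Short Γ
  shorten okΓ (r x) = 1 , r x , s≤s z≤n
  shorten okΓ (lp {M = a} {N = b} p d) =
    left-rule (a ∷ b ∷ []) (both a b (All-lookup okΓ p) (first a b) (second a b)) okΓ shorten (lp p) d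
  shorten okΓ (le {M = a} {K = k} p k⊩ d) =
    left-rule (a ∷ k ∷ []) (both a k (All-lookup okΓ p) (first a k) (second a k)) okΓ shorten (le p k⊩) d
  shorten okΓ (blind₁ {M = a} {K = k} p k⊩ d) =
    left-rule (a ∷ k ∷ []) (both a k (All-lookup okΓ p) (first a k) (second a k)) okΓ shorten (blind₁ p k⊩) d
  shorten okΓ (lsign {M = a} {K = k} p q e d) =
    left-rule (a ∷ []) (psub-closed (inj₁ (All-lookup okΓ p)) (first a k) ∷ []) okΓ shorten (lsign p q e) d
  shorten okΓ (blind₂ {M = a} {R = ρ} {K = k} p ρ⊩ d) =
    left-rule (sign a k ∷ ρ ∷ [])
      (unblind-closed okp ∷ psub-closed (inj₁ okp) (∈-++⁺ˡ (there (second a ρ))) ∷ [])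
      okΓ shorten (blind₂ p ρ⊩) d
    where okp = All-lookup okΓ p
  shorten {Γ} okΓ (ls {A = A} (N , N∈ , factor) a d) =
    left-rule (A ∷ []) (psub-closed (hyp-or-goal N∈) (Subterms.factor-psub S factor) ∷ []) okΓ
      shorten (ls (N , N∈ , factor) a) d
    where
    hyp-or-goal : ∀ {N} → N ∈ M ∷ Γ → Ok N ⊎ N ≡ M
    hyp-or-goal (here N≡M) = inj₂ N≡M
    hyp-or-goal (there N∈Γ) = inj₁ (All-lookup okΓ N∈Γ)

module Bound (S : Sig) (M : Msg S) (Γ : List (Msg S)) where
  open Subterms S
  open Saturation S (M ∷ Γ)
  open import Data.List.Membership.DecPropositional (_≟_ S) using (_∈?_)

  -- A member of U = St(M,Γ) of maximal size (U contains M, so it is nonempty).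
  ⊤ : Msg S
  ⊤ = argmax size M U

  ⊤∈U : ⊤ ∈ U
  ⊤∈U with argmax-sel size M U
  ... | inj₁ ⊤≡M = subst (_∈ U) (sym ⊤≡M) (L⊆U (here refl))
  ... | inj₂ ⊤∈U′ = ⊤∈U′

  ≤⊤ : ∀ {x} → x ∈ U → size x ≤ size ⊤
  ≤⊤ = All-lookup (f[xs]≤f[argmax] {f = size} M U)

  Reachable : Msg S → Set
  Reachable x = x ∈ Γ ⊎ (x ∈ U × size x < size ⊤)

  reachable? : Decidable Reachable
  reachable? x = (x ∈? Γ) ⊎-dec ((x ∈? U) ×-dec (size x <? size ⊤))

  reachable⊆U : ∀ {x} → Reachable x → x ∈ U
  reachable⊆U (inj₁ x∈Γ)     = L⊆U (there x∈Γ)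
  reachable⊆U (inj₂ (x∈U , _)) = x∈U

  smaller-reachable : ∀ {y z} → y ∈ U → z ∈ U → size z < size y → Reachable z
  smaller-reachable y∈U z∈U z<y = inj₂ (z∈U , <-≤-trans z<y (≤⊤ y∈U))

  closed : Closed S M Reachable
  closed = record
    { psub-closed = λ { {y} y-ok z∈y →
        let y∈U = [ reachable⊆U , (λ { refl → L⊆U (here refl) }) ]′ y-ok in
        smaller-reachable y∈U (P⊆U (psub∈P y∈U z∈y)) (psub-< y z∈y) }
    ; unblind-closed = λ { {a} {ρ} {k} s-ok →
        let s∈U = reachable⊆U s-ok in
        smaller-reachable s∈U (unblind∈U s∈U) (unblind-< a ρ k) }
    }

  hypotheses-reachable : All Reachable Γ
  hypotheses-reachable = tabulate inj₁

  ⊤-not-missing : Reachable ⊤ → ⊤ ∈ Γ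
  ⊤-not-missing (inj₁ ⊤∈Γ)      = ⊤∈Γ
  ⊤-not-missing (inj₂ (_ , ⊤<⊤)) = ⊥-elim (<-irrefl refl ⊤<⊤)

lemma4p8 : (S : Sig) (E : Theory S) → Convergent S E →
    (Γ : List (Msg S)) (M : Msg S) →
    All (Normal S E) Γ → Normal S E M →
    (n : ℕ) → Deriv S E Γ M n →
    Σ ℕ (λ m → Deriv S E Γ M m × m ≤ card S (St S (M ∷ Γ)))
lemma4p8 S E _ Γ M _ _ _ d = within-card (shorten hypotheses-reachable d)
  where
  open Saturation S (M ∷ Γ) using (U)
  open Bound S M Γ
  open Shortening S E M Reachable reachable? closed
         (deduplicate (_≟_ S) U) (λ ok → ∈-deduplicate⁺ (_≟_ S) (reachable⊆U ok))

  -- ⊤ is listed but never missing, so 1 + #missing ≤ #St(M,Γ).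
  within-card : Short Γ → Σ ℕ (λ m → Deriv S E Γ M m × m ≤ card S (St S (M ∷ Γ)))
  within-card (m , d′ , m≤) =
    m , d′ , ≤-trans m≤ (missing-bound (∈-deduplicate⁺ (_≟_ S) ⊤∈U) ⊤-not-missing)
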